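{- Let $\mathbf{k}$ be a commutative ring, $q\in\mathbf{k}$, $s$ a positive integer and $I\subseteq[s-1]$. Then \[\eta^{(q)}_I=(q+1)\sum_{J\subseteq[s-1]}(-1)^{|J|}(-q)^{|J\setminus I|}L_J.\]
   Context: Let $x_1,x_2,\dots$ be commuting indeterminates. For $J\subseteq[s-1]$, Gessel's fundamental quasisymmetric function is $L_J=\sum x_{i_1}\cdots x_{i_s}$ over $i_1\le\cdots\le i_s$ with $j\in J\Rightarrow i_j<i_{j+1}$, and $\eta^{(q)}_I=\sum(q+1)^{|\{i_1,\dots,i_s\}|}x_{i_1}\cdots x_{i_s}$ over $i_1\le\cdots\le i_s$ with $j\in I\Rightarrow i_j=i_{j+1}$ (sums over sequences of positive integers, in $\mathbf{k}[[x_1,x_2,\dots]]$). -}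

module Defs where

open import Level using (Level)
open import Algebra.Bundles using (CommutativeRing)
open import Data.Nat as ℕ using (ℕ; zero; suc; _<_; _≤_)
open import Data.Nat.Properties using (_<?_; _≟_)
open import Data.Fin using (Fin; inject₁) renaming (suc to fsuc)
open import Data.Fin.Properties using (all?)
open import Data.Fin.Subset using (Subset; _∈_; _∉_; inside; outside)
open import Data.Fin.Subset.Properties using (_∈?_)
open import Data.Vec using ([]; _∷_)
open import Data.List using (List; length; deduplicate)
open import Data.List.Base using (tabulate)
open import Data.Bool using (if_then_else_)
open import Relation.Nullary using (Dec; does; ¬?; _→-dec_)

-- A monomial x_{i_1} ⋯ x_{i_s} of degree s = suc n is encoded by the
-- weakly increasing sequence i : Fin (suc n) → ℕ of its indices
-- (index value a ∈ ℕ stands for the variable x_{a+1}).  Every monomial of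
-- degree s has exactly one such sequence, so a homogeneous degree-s power
-- series in k[[x_1,x_2,…]] is determined by its coefficient function on
-- weakly increasing sequences.

WeaklyIncreasing : {n : ℕ} → (Fin (suc n) → ℕ) → Set
WeaklyIncreasing {n} i = (j : Fin n) → i (inject₁ j) ≤ i (fsuc j)

distinct : {n : ℕ} → (Fin (suc n) → ℕ) → ℕ
distinct i = length (deduplicate _≟_ (tabulate i))

module QSym {c ℓ : Level} (R : CommutativeRing c ℓ) where
  open CommutativeRing R

  pow : Carrier → ℕ → Carrier
  pow x zero = 1#
  pow x (suc k) = x * pow x k

  sumSubsets : {n : ℕ} → (Subset n → Carrier) → Carrier
  sumSubsets {zero} f = f []
  sumSubsets {suc n} f =
    sumSubsets (λ J → f (outside ∷ J)) + sumSubsets (λ J → f (inside ∷ J))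

  indicator : {P : Set} → Dec P → Carrier
  indicator d = if does d then 1# else 0#

  -- coefficient of the monomial encoded by i in Gessel's L_J
  -- (J ⊆ [s-1], s = suc n; position j ∈ Fin n compares i_j with i_{j+1})
  L : {n : ℕ} → Subset n → (Fin (suc n) → ℕ) → Carrier
  L J i = indicator (all? (λ j → (j ∈? J) →-dec (i (inject₁ j) <? i (fsuc j))))

  η : {n : ℕ} → Carrier → Subset n → (Fin (suc n) → ℕ) → Carrier
  η q I i =
    indicator (all? (λ j → (j ∈? I) →-dec (i (inject₁ j) ≟ i (fsuc j))))
    * pow (q + 1#) (distinct i)

{-# OPTIONS --safe #-}
-- Induction on the length of the index sequence, splitting off its first step i₁ ≤ i₂.
-- If i₁ = i₂, the terms of the sum with 1 ∈ J vanish, and both sides are those of the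
-- shortened sequence.  If i₁ < i₂ and 1 ∈ I, then η vanishes and the terms with 1 ∈ J
-- cancel those with 1 ∉ J.  If i₁ < i₂ and 1 ∉ I, the new distinct value multiplies η
-- by q + 1, and the terms with 1 ∈ J add q times the sum of the shortened sequence.
module Submission where

open import Defs
open import Level using (Level; _⊔_; 0ℓ)
open import Algebra.Bundles using (CommutativeRing)
open import Data.Nat using (ℕ; zero; suc; _<_; _≤_)
open import Data.Nat.Properties using (_<?_; _≟_; ≤-refl; ≤-trans; <-≤-trans; <⇒≢; m≤n⇒m<n∨m≡n)
open import Data.Fin using (Fin; inject₁) renaming (zero to fzero; suc to fsuc)
open import Data.Fin.Subset using (Subset; Side; inside; outside; _∈_; ∣_∣; _─_)
open import Data.Fin.Subset.Properties using (_∈?_)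
open import Data.Fin.Properties using (all?)
open import Data.Vec using ([]; _∷_; here; there)
open import Data.List using (length; deduplicate; tabulate) renaming (_∷_ to _∷ˡ_)
open import Data.List.Properties using (filter-all; filter-reject; filter-idem)
open import Data.List.Relation.Unary.All as All using (All) renaming ([] to []ᵃ; _∷_ to _∷ᵃ_)
open import Data.List.Relation.Unary.All.Properties using (deduplicate⁺)
open import Data.Bool using (if_then_else_)
open import Data.Sum using (inj₁; inj₂)
open import Function using (_∘_)
open import Function.Bundles using (mk⇔)
open import Relation.Binary using (Rel; Decidable; DecidableEquality)
open import Relation.Binary.PropositionalEquality as ≡ using (_≡_; _≢_; refl; cong; cong₂)
open import Relation.Nullary using (Dec; ¬_; ¬?; _→-dec_)
open import Relation.Nullary.Decidable using (does-⇔; dec-true; dec-false)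
import Algebra.Properties.Ring as RingProperties
import Algebra.Properties.CommutativeSemigroup as CommutativeSemigroupProperties
import Relation.Binary.Reasoning.Setoid as SetoidReasoning

module _ {a} {A : Set a} (_≟ᴬ_ : DecidableEquality A) where

  deduplicate-∷-∷ : ∀ {x y} xs → x ≡ y → deduplicate _≟ᴬ_ (x ∷ˡ y ∷ˡ xs) ≡ deduplicate _≟ᴬ_ (y ∷ˡ xs)
  deduplicate-∷-∷ {x} xs refl = cong (x ∷ˡ_) (≡.trans
    (filter-reject (¬? ∘ (x ≟ᴬ_)) (λ x≢x → x≢x refl))
    (filter-idem (¬? ∘ (x ≟ᴬ_)) (deduplicate _≟ᴬ_ xs)))

  deduplicate-∷-fresh : ∀ {x xs} → All (x ≢_) xs →
                        deduplicate _≟ᴬ_ (x ∷ˡ xs) ≡ x ∷ˡ deduplicate _≟ᴬ_ xs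
  deduplicate-∷-fresh {x} x∉xs =
    cong (x ∷ˡ_) (filter-all (¬? ∘ (x ≟ᴬ_)) (deduplicate⁺ _≟ᴬ_ x∉xs))

weaklyIncreasing-tail : ∀ {n} {i : Fin (suc (suc n)) → ℕ} → WeaklyIncreasing i → WeaklyIncreasing (i ∘ fsuc)
weaklyIncreasing-tail wi j = wi (fsuc j)

head≤-tabulate : ∀ {n} {i : Fin (suc n) → ℕ} → WeaklyIncreasing i → All (i fzero ≤_) (tabulate i)
head≤-tabulate {zero} wi = ≤-refl ∷ᵃ []ᵃ
head≤-tabulate {suc n} {i} wi =
  ≤-refl ∷ᵃ All.map (≤-trans (wi fzero)) (head≤-tabulate {i = i ∘ fsuc} (weaklyIncreasing-tail {i = i} wi))

distinct-∷-≡ : ∀ {n} {i : Fin (suc (suc n)) → ℕ} →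
               i fzero ≡ i (fsuc fzero) → distinct i ≡ distinct (i ∘ fsuc)
distinct-∷-≡ {i = i} eq = cong length (deduplicate-∷-∷ _≟_ (tabulate (i ∘ fsuc ∘ fsuc)) eq)

distinct-∷-< : ∀ {n} {i : Fin (suc (suc n)) → ℕ} → WeaklyIncreasing i →
               i fzero < i (fsuc fzero) → distinct i ≡ suc (distinct (i ∘ fsuc))
distinct-∷-< {i = i} wi lt = cong length (deduplicate-∷-fresh _≟_ (All.map (λ le → <⇒≢ (<-≤-trans lt le))
  (head≤-tabulate {i = i ∘ fsuc} (weaklyIncreasing-tail {i = i} wi))))

consecutive? : ∀ {a} {A : Set a} {_~_ : Rel A 0ℓ} {n} → Decidable _~_ →
               (J : Subset n) (i : Fin (suc n) → A) → Dec (∀ j → j ∈ J → i (inject₁ j) ~ i (fsuc j))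
consecutive? _~?_ J i = all? (λ j → (j ∈? J) →-dec (i (inject₁ j) ~? i (fsuc j)))

module Expansion {c ℓ : Level} (R : CommutativeRing c ℓ) where
  open CommutativeRing R hiding (zero) renaming (refl to ≈-refl)
  open QSym R
  open RingProperties ring using (-1*x≈-x; -‿involutive)
  open CommutativeSemigroupProperties *-commutativeSemigroup using (interchange; x∙yz≈y∙xz)
  open SetoidReasoning setoid

  -- By definition, L J i is consecutive _<?_ J i and the first factor of η q I i
  -- is consecutive _≟_ I i.
  consecutive : ∀ {a} {A : Set a} {_~_ : Rel A 0ℓ} {n} →
                Decidable _~_ → Subset n → (Fin (suc n) → A) → Carrier
  consecutive _~?_ J i = indicator (consecutive? _~?_ J i)

  module _ {a} {A : Set a} {_~_ : Rel A 0ℓ} (_~?_ : Decidable _~_) where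

    consecutive-[] : (i : Fin 1 → A) → consecutive _~?_ [] i ≡ 1#
    consecutive-[] i = cong (λ b → if b then 1# else 0#) (dec-true (consecutive? _~?_ [] i) (λ ()))

    consecutive-∷ : ∀ {n} b (J : Subset n) (i : Fin (suc (suc n)) → A) →
                    (b ≡ inside → i fzero ~ i (fsuc fzero)) →
                    consecutive _~?_ (b ∷ J) i ≡ consecutive _~?_ J (i ∘ fsuc)
    consecutive-∷ b J i head = cong (λ b → if b then 1# else 0#) (does-⇔ (mk⇔
      (λ all j j∈J → all (fsuc j) (there j∈J))
      (λ { all fzero here → head refl ; all (fsuc j) (there j∈J) → all j j∈J }))
      (consecutive? _~?_ (b ∷ J) i) (consecutive? _~?_ J (i ∘ fsuc)))

    consecutive-∷-≁ : ∀ {n} (J : Subset n) (i : Fin (suc (suc n)) → A) →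
                      ¬ (i fzero ~ i (fsuc fzero)) → consecutive _~?_ (inside ∷ J) i ≡ 0#
    consecutive-∷-≁ J i ≁ = cong (λ b → if b then 1# else 0#)
      (dec-false (consecutive? _~?_ (inside ∷ J) i) (λ all → ≁ (all fzero here)))

  sumSubsets-cong : ∀ {n} {f g : Subset n → Carrier} → (∀ J → f J ≈ g J) → sumSubsets f ≈ sumSubsets g
  sumSubsets-cong {zero} f≈g = f≈g []
  sumSubsets-cong {suc n} f≈g =
    +-cong (sumSubsets-cong (λ J → f≈g (outside ∷ J))) (sumSubsets-cong (λ J → f≈g (inside ∷ J)))

  sumSubsets-*ˡ : ∀ {n} x (f : Subset n → Carrier) → sumSubsets (λ J → x * f J) ≈ x * sumSubsets f
  sumSubsets-*ˡ {zero} x f = ≈-refl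
  sumSubsets-*ˡ {suc n} x f = begin
    sumSubsets (λ J → x * f (outside ∷ J)) + sumSubsets (λ J → x * f (inside ∷ J))
      ≈⟨ +-cong (sumSubsets-*ˡ x (f ∘ (outside ∷_))) (sumSubsets-*ˡ x (f ∘ (inside ∷_))) ⟩
    x * sumSubsets (λ J → f (outside ∷ J)) + x * sumSubsets (λ J → f (inside ∷ J))
      ≈⟨ sym (distribˡ x _ _) ⟩
    x * sumSubsets f ∎

  signedL : ∀ {n} → Carrier → Subset n → (Fin (suc n) → ℕ) → Subset n → Carrier
  signedL q I i J = pow (- 1#) ∣ J ∣ * pow (- q) ∣ J ─ I ∣ * L J i

  alternatingL : ∀ {n} → Carrier → Subset n → (Fin (suc n) → ℕ) → Carrier
  alternatingL q I i = sumSubsets (signedL q I i)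

  module _ (q : Carrier) {n} (I : Subset n) (i : Fin (suc (suc n)) → ℕ) where

    -- Split on y: the head of J ─ (y ∷ I) only computes once y is known.
    signedL-outside : ∀ y J → signedL q (y ∷ I) i (outside ∷ J) ≡ signedL q I (i ∘ fsuc) J
    signedL-outside inside  J = cong (_ *_) (consecutive-∷ _<?_ outside J i (λ ()))
    signedL-outside outside J = cong (_ *_) (consecutive-∷ _<?_ outside J i (λ ()))

    alternatingL-∷ : ∀ y x → (∀ J → signedL q (y ∷ I) i (inside ∷ J) ≈ x * signedL q I (i ∘ fsuc) J) →
                     alternatingL q (y ∷ I) i ≈ (1# + x) * alternatingL q I (i ∘ fsuc)
    alternatingL-∷ y x inside≈ = begin
      alternatingL q (y ∷ I) i
        ≈⟨ +-cong (sumSubsets-cong (reflexive ∘ signedL-outside y)) (sumSubsets-cong inside≈) ⟩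
      alternatingL q I (i ∘ fsuc) + sumSubsets (λ J → x * signedL q I (i ∘ fsuc) J)
        ≈⟨ +-cong (sym (*-identityˡ _)) (sumSubsets-*ˡ x (signedL q I (i ∘ fsuc))) ⟩
      1# * alternatingL q I (i ∘ fsuc) + x * alternatingL q I (i ∘ fsuc)
        ≈⟨ sym (distribʳ _ 1# x) ⟩
      (1# + x) * alternatingL q I (i ∘ fsuc) ∎

  record HeadStep (q : Carrier) {n} (y : Side) (I : Subset n) (i : Fin (suc (suc n)) → ℕ) : Set (c ⊔ ℓ) where
    field
      factor : Carrier
      η-∷ : η q (y ∷ I) i ≈ (1# + factor) * η q I (i ∘ fsuc)
      signedL-inside : ∀ J → signedL q (y ∷ I) i (inside ∷ J) ≈ factor * signedL q I (i ∘ fsuc) J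

  module _ (q : Carrier) {n} (I : Subset n) (i : Fin (suc (suc n)) → ℕ) where

    headStep-≡ : ∀ y → i fzero ≡ i (fsuc fzero) → HeadStep q y I i
    headStep-≡ y eq = record
      { factor = 0#
      ; η-∷ = begin
          η q (y ∷ I) i
            ≡⟨ cong₂ (λ e d → e * pow (q + 1#) d)
                     (consecutive-∷ _≟_ y I i (λ _ → eq)) (distinct-∷-≡ {i = i} eq) ⟩
          η q I (i ∘ fsuc)           ≈⟨ sym (*-identityˡ _) ⟩
          1# * η q I (i ∘ fsuc)      ≈⟨ *-congʳ (sym (+-identityʳ 1#)) ⟩
          (1# + 0#) * η q I (i ∘ fsuc) ∎
      ; signedL-inside = λ J → begin
          signedL q (y ∷ I) i (inside ∷ J)
            ≡⟨ cong (_ *_) (consecutive-∷-≁ _<?_ J i (λ lt → <⇒≢ lt eq)) ⟩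
          _ * 0#                          ≈⟨ zeroʳ _ ⟩
          0#                              ≈⟨ sym (zeroˡ _) ⟩
          0# * signedL q I (i ∘ fsuc) J ∎
      }

    headStep-<-inside : i fzero < i (fsuc fzero) → HeadStep q inside I i
    headStep-<-inside lt = record
      { factor = - 1#
      ; η-∷ = begin
          η q (inside ∷ I) i
            ≡⟨ cong (_* pow (q + 1#) (distinct i)) (consecutive-∷-≁ _≟_ I i (<⇒≢ lt)) ⟩
          0# * _                          ≈⟨ zeroˡ _ ⟩
          0#                              ≈⟨ sym (zeroˡ _) ⟩
          0# * η q I (i ∘ fsuc)           ≈⟨ *-congʳ (sym (-‿inverseʳ 1#)) ⟩
          (1# + - 1#) * η q I (i ∘ fsuc) ∎
      ; signedL-inside = λ J → begin
          - 1# * pow (- 1#) ∣ J ∣ * pow (- q) ∣ J ─ I ∣ * consecutive _<?_ (inside ∷ J) i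
            ≡⟨ cong (_ *_) (consecutive-∷ _<?_ inside J i (λ _ → lt)) ⟩
          - 1# * pow (- 1#) ∣ J ∣ * pow (- q) ∣ J ─ I ∣ * L J (i ∘ fsuc)
            ≈⟨ *-congʳ (*-assoc _ _ _) ⟩
          - 1# * (pow (- 1#) ∣ J ∣ * pow (- q) ∣ J ─ I ∣) * L J (i ∘ fsuc)
            ≈⟨ *-assoc _ _ _ ⟩
          - 1# * signedL q I (i ∘ fsuc) J ∎
      }

    headStep-<-outside : WeaklyIncreasing i → i fzero < i (fsuc fzero) → HeadStep q outside I i
    headStep-<-outside wi lt = record
      { factor = q
      ; η-∷ = begin
          η q (outside ∷ I) i
            ≡⟨ cong₂ (λ e d → e * pow (q + 1#) d)
                     (consecutive-∷ _≟_ outside I i (λ ())) (distinct-∷-< {i = i} wi lt) ⟩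
          _ * ((q + 1#) * _)              ≈⟨ x∙yz≈y∙xz _ _ _ ⟩
          (q + 1#) * η q I (i ∘ fsuc)    ≈⟨ *-congʳ (+-comm q 1#) ⟩
          (1# + q) * η q I (i ∘ fsuc) ∎
      ; signedL-inside = λ J → begin
          - 1# * pow (- 1#) ∣ J ∣ * (- q * pow (- q) ∣ J ─ I ∣) * consecutive _<?_ (inside ∷ J) i
            ≡⟨ cong (_ *_) (consecutive-∷ _<?_ inside J i (λ _ → lt)) ⟩
          - 1# * pow (- 1#) ∣ J ∣ * (- q * pow (- q) ∣ J ─ I ∣) * L J (i ∘ fsuc)
            ≈⟨ *-congʳ (interchange _ _ _ _) ⟩
          - 1# * - q * (pow (- 1#) ∣ J ∣ * pow (- q) ∣ J ─ I ∣) * L J (i ∘ fsuc)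
            ≈⟨ *-congʳ (*-congʳ (trans (-1*x≈-x (- q)) (-‿involutive q))) ⟩
          q * (pow (- 1#) ∣ J ∣ * pow (- q) ∣ J ─ I ∣) * L J (i ∘ fsuc)
            ≈⟨ *-assoc _ _ _ ⟩
          q * signedL q I (i ∘ fsuc) J ∎
      }

    headStep : WeaklyIncreasing i → ∀ y → HeadStep q y I i
    headStep wi y with m≤n⇒m<n∨m≡n (wi fzero)
    headStep wi y       | inj₂ eq = headStep-≡ y eq
    headStep wi inside  | inj₁ lt = headStep-<-inside lt
    headStep wi outside | inj₁ lt = headStep-<-outside wi lt

  η≈alternatingL : ∀ q n (I : Subset n) (i : Fin (suc n) → ℕ) → WeaklyIncreasing i →
                   η q I i ≈ (q + 1#) * alternatingL q I i
  η≈alternatingL q zero [] i _ = begin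
    η q [] i                      ≡⟨ cong (_* pow (q + 1#) 1) (consecutive-[] _≟_ i) ⟩
    1# * ((q + 1#) * 1#)          ≈⟨ *-identityˡ _ ⟩
    (q + 1#) * 1#                 ≈⟨ *-congˡ (sym (trans (*-identityʳ _) (*-identityʳ 1#))) ⟩
    (q + 1#) * (1# * 1# * 1#)     ≡⟨ cong (λ l → (q + 1#) * (1# * 1# * l)) (consecutive-[] _<?_ i) ⟨
    (q + 1#) * alternatingL q [] i ∎
  η≈alternatingL q (suc n) (y ∷ I) i wi = begin
    η q (y ∷ I) i                                ≈⟨ η-∷ ⟩
    (1# + factor) * η q I i′                     ≈⟨ *-congˡ (η≈alternatingL q n I i′ (weaklyIncreasing-tail {i = i} wi)) ⟩
    (1# + factor) * ((q + 1#) * alternatingL q I i′) ≈⟨ x∙yz≈y∙xz _ _ _ ⟩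
    (q + 1#) * ((1# + factor) * alternatingL q I i′) ≈⟨ *-congˡ (alternatingL-∷ q I i y factor signedL-inside) ⟨
    (q + 1#) * alternatingL q (y ∷ I) i ∎
    where
    i′ : Fin (suc n) → ℕ
    i′ = i ∘ fsuc
    open HeadStep (headStep q I i wi y)

proposition3p8 : {c ℓ : Level} (R : CommutativeRing c ℓ) →
    let open CommutativeRing R
        open QSym R
    in (q : Carrier) (n : ℕ) (I : Subset n) (i : Fin (suc n) → ℕ) →
       WeaklyIncreasing i →
       η q I i ≈ (q + 1#) * sumSubsets (λ J → pow (- 1#) ∣ J ∣ * pow (- q) ∣ J ─ I ∣ * L J i)
proposition3p8 R = Expansion.η≈alternatingL R
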